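{- Let $\mathcal{B}$ be the set of blocking games and $G,H$ strictly $\mathscr{P}$-free elements of $\mathcal{B}$ such that $o(G)=\mathscr{L}$ and $H$ is a Left end. Then $o(G+H)=\mathscr{L}$.
   Context: Games are short misère-play game forms (no tombstones); outcomes $o(G)\in\{\mathscr{L},\mathscr{N},\mathscr{P},\mathscr{R}\}$; $+$ is disjunctive sum. A subposition of $G$ is any game reachable by a possibly empty, not necessarily alternating, sequence of moves; $G$ is strictly $\mathscr{P}$-free if no subposition has outcome $\mathscr{P}$. A Left end is a game with no Left options (Right end symmetrically). A Left end $X$ is blocked if for every Right option $X^R$, either $X^R$ is a blocked Left end or some Left option $X^{RL}$ of $X^R$ is a blocked Left end; blocked Right ends symmetrically. A game is blocking if every subposition that is a Left (resp. Right) end is a blocked Left (resp. Right) end. -}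

module Defs where

open import Data.List using (List; []; _∷_; _++_)
open import Data.List.Membership.Propositional using (_∈_)
open import Data.Product using (_×_; Σ)
open import Data.Sum using (_⊎_)
open import Relation.Nullary using (¬_)
open import Relation.Binary.PropositionalEquality using (_≡_)

data Game : Set where
  game : List Game → List Game → Game

leftOpts : Game → List Game
leftOpts (game Ls _) = Ls

rightOpts : Game → List Game
rightOpts (game _ Rs) = Rs

mutual
  _⊕_ : Game → Game → Game
  G@(game Ls Rs) ⊕ H@(game Ls' Rs') =
    game (addL Ls H ++ addR G Ls') (addL Rs H ++ addR G Rs')

  addL : List Game → Game → List Game
  addL [] H = []
  addL (x ∷ xs) H = (x ⊕ H) ∷ addL xs H

  addR : Game → List Game → List Game
  addR G [] = []
  addR G (y ∷ ys) = (G ⊕ y) ∷ addR G ys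

-- Misère play winning conditions (a player with no move on their turn wins).
mutual
  data LeftWinsFirst : Game → Set where
    lf-end  : ∀ {Rs} → LeftWinsFirst (game [] Rs)
    lf-move : ∀ {Ls Rs G'} → G' ∈ Ls → LeftWinsSecond G' → LeftWinsFirst (game Ls Rs)

  data LeftWinsSecond : Game → Set where
    ls : ∀ {Ls R Rs} → (∀ {G'} → G' ∈ (R ∷ Rs) → LeftWinsFirst G') →
         LeftWinsSecond (game Ls (R ∷ Rs))

mutual
  data RightWinsFirst : Game → Set where
    rf-end  : ∀ {Ls} → RightWinsFirst (game Ls [])
    rf-move : ∀ {Ls Rs G'} → G' ∈ Rs → RightWinsSecond G' → RightWinsFirst (game Ls Rs)

  data RightWinsSecond : Game → Set where
    rs : ∀ {L Ls Rs} → (∀ {G'} → G' ∈ (L ∷ Ls) → RightWinsFirst G') →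
         RightWinsSecond (game (L ∷ Ls) Rs)

data Outcome : Set where
  𝓛 𝓝 𝓟 𝓡 : Outcome

_HasOutcome_ : Game → Outcome → Set
G HasOutcome 𝓛 = LeftWinsFirst G × LeftWinsSecond G
G HasOutcome 𝓝 = LeftWinsFirst G × RightWinsFirst G
G HasOutcome 𝓟 = RightWinsSecond G × LeftWinsSecond G
G HasOutcome 𝓡 = RightWinsSecond G × RightWinsFirst G

data Subposition : Game → Game → Set where
  sp-refl  : ∀ {G} → Subposition G G
  sp-left  : ∀ {K G G'} → G' ∈ leftOpts G → Subposition K G' → Subposition K G
  sp-right : ∀ {K G G'} → G' ∈ rightOpts G → Subposition K G' → Subposition K G

StrictlyPFree : Game → Set
StrictlyPFree G = ∀ {K} → Subposition K G → ¬ (K HasOutcome 𝓟)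

IsLeftEnd : Game → Set
IsLeftEnd G = leftOpts G ≡ []

IsRightEnd : Game → Set
IsRightEnd G = rightOpts G ≡ []

data BlockedLeftEnd : Game → Set where
  bl : ∀ {Rs} →
       (∀ {X'} → X' ∈ Rs →
          BlockedLeftEnd X' ⊎ Σ Game (λ Y → Y ∈ leftOpts X' × BlockedLeftEnd Y)) →
       BlockedLeftEnd (game [] Rs)

data BlockedRightEnd : Game → Set where
  br : ∀ {Ls} →
       (∀ {X'} → X' ∈ Ls →
          BlockedRightEnd X' ⊎ Σ Game (λ Y → Y ∈ rightOpts X' × BlockedRightEnd Y)) →
       BlockedRightEnd (game Ls [])

Blocking : Game → Set
Blocking G = ∀ {K} → Subposition K G →
  (IsLeftEnd K → BlockedLeftEnd K) × (IsRightEnd K → BlockedRightEnd K)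

{-# OPTIONS --safe #-}
-- Left plays G + H by a winning strategy for G and never moves in H. The H component
-- stays a blocked Left end: when Right moves it to H^R, either H^R is itself one, or
-- Left restores this by moving to a Left option of H^R that is one. In the first case
-- Left must move first in a G' that Left won as second player; as G' is not a
-- P-position, Left wins it playing first too. When Left has no move in G, the sum is a
-- Left end, a misère win for Left.
module Submission where

open import Defs
open import Data.List using ([]; _∷_; map)
open import Data.List.Membership.Propositional using (_∈_)
open import Data.List.Membership.Propositional.Properties
  using (∈-map⁺; ∈-map⁻; ∈-++⁺ˡ; ∈-++⁺ʳ; ∈-++⁻)
open import Data.List.Relation.Unary.Any using (here; there)
open import Data.Product using (_×_; _,_; proj₁; ∃-syntax)
open import Data.Sum using (_⊎_; inj₁; inj₂)
open import Data.Empty using (⊥-elim)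
open import Relation.Nullary using (¬_)
open import Relation.Binary.PropositionalEquality using (_≡_; refl; sym; cong; subst)

addL≡map : ∀ xs H → addL xs H ≡ map (_⊕ H) xs
addL≡map []       H = refl
addL≡map (x ∷ xs) H = cong ((x ⊕ H) ∷_) (addL≡map xs H)

addR≡map : ∀ G ys → addR G ys ≡ map (G ⊕_) ys
addR≡map G []       = refl
addR≡map G (y ∷ ys) = cong ((G ⊕ y) ∷_) (addR≡map G ys)

∈-leftOpts-⊕ˡ : ∀ {G'} G H → G' ∈ leftOpts G → G' ⊕ H ∈ leftOpts (G ⊕ H)
∈-leftOpts-⊕ˡ (game Ls _) H@(game _ _) p =
  ∈-++⁺ˡ (subst (_ ∈_) (sym (addL≡map Ls H)) (∈-map⁺ (_⊕ H) p))

∈-leftOpts-⊕ʳ : ∀ {H'} G H → H' ∈ leftOpts H → G ⊕ H' ∈ leftOpts (G ⊕ H)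
∈-leftOpts-⊕ʳ G@(game Ls _) (game Ls' _) p =
  ∈-++⁺ʳ (addL Ls _) (subst (_ ∈_) (sym (addR≡map G Ls')) (∈-map⁺ (G ⊕_) p))

∈-rightOpts-⊕⁻ : ∀ G H {X} → X ∈ rightOpts (G ⊕ H) →
  (∃[ G' ] G' ∈ rightOpts G × X ≡ G' ⊕ H) ⊎ (∃[ H' ] H' ∈ rightOpts H × X ≡ G ⊕ H')
∈-rightOpts-⊕⁻ G@(game _ Rs) H@(game _ Rs') {X} m with ∈-++⁻ (addL Rs H) m
... | inj₁ m₁ = inj₁ (∈-map⁻ (_⊕ H) (subst (X ∈_) (addL≡map Rs H) m₁))
... | inj₂ m₂ = inj₂ (∈-map⁻ (G ⊕_) (subst (X ∈_) (addR≡map G Rs') m₂))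

∈-rightOpts-⊕-elim : ∀ G H (P : Game → Set) →
  (∀ {G'} → G' ∈ rightOpts G → P (G' ⊕ H)) →
  (∀ {H'} → H' ∈ rightOpts H → P (G ⊕ H')) →
  ∀ {X} → X ∈ rightOpts (G ⊕ H) → P X
∈-rightOpts-⊕-elim G H P onG onH m with ∈-rightOpts-⊕⁻ G H m
... | inj₁ (_ , p , refl) = onG p
... | inj₂ (_ , p , refl) = onH p

mutual
  leftWinsFirst⊎rightWinsSecond : ∀ G → LeftWinsFirst G ⊎ RightWinsSecond G
  leftWinsFirst⊎rightWinsSecond (game [] Rs) = inj₁ lf-end
  leftWinsFirst⊎rightWinsSecond (game (L ∷ Ls) Rs)
    with anyLeftWinsSecond⊎allRightWinFirst (L ∷ Ls)
  ... | inj₁ (_ , p , w) = inj₁ (lf-move p w)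
  ... | inj₂ all         = inj₂ (rs all)

  leftWinsSecond⊎rightWinsFirst : ∀ G → LeftWinsSecond G ⊎ RightWinsFirst G
  leftWinsSecond⊎rightWinsFirst (game Ls []) = inj₂ rf-end
  leftWinsSecond⊎rightWinsFirst (game Ls (R ∷ Rs))
    with anyRightWinsSecond⊎allLeftWinFirst (R ∷ Rs)
  ... | inj₁ (_ , p , w) = inj₂ (rf-move p w)
  ... | inj₂ all         = inj₁ (ls all)

  anyLeftWinsSecond⊎allRightWinFirst : ∀ xs →
    (∃[ x ] x ∈ xs × LeftWinsSecond x) ⊎ (∀ {x} → x ∈ xs → RightWinsFirst x)
  anyLeftWinsSecond⊎allRightWinFirst [] = inj₂ λ ()
  anyLeftWinsSecond⊎allRightWinFirst (x ∷ xs) with leftWinsSecond⊎rightWinsFirst x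
  ... | inj₁ w = inj₁ (x , here refl , w)
  ... | inj₂ r with anyLeftWinsSecond⊎allRightWinFirst xs
  ...   | inj₁ (y , p , w) = inj₁ (y , there p , w)
  ...   | inj₂ all = inj₂ λ { (here refl) → r ; (there p) → all p }

  anyRightWinsSecond⊎allLeftWinFirst : ∀ xs →
    (∃[ x ] x ∈ xs × RightWinsSecond x) ⊎ (∀ {x} → x ∈ xs → LeftWinsFirst x)
  anyRightWinsSecond⊎allLeftWinFirst [] = inj₂ λ ()
  anyRightWinsSecond⊎allLeftWinFirst (x ∷ xs) with leftWinsFirst⊎rightWinsSecond x
  ... | inj₂ w = inj₁ (x , here refl , w)
  ... | inj₁ l with anyRightWinsSecond⊎allLeftWinFirst xs
  ...   | inj₁ (y , p , w) = inj₁ (y , there p , w)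
  ...   | inj₂ all = inj₂ λ { (here refl) → l ; (there p) → all p }

leftWinsSecond⇒leftWinsFirst : ∀ {G} → ¬ G HasOutcome 𝓟 → LeftWinsSecond G → LeftWinsFirst G
leftWinsSecond⇒leftWinsFirst {G} ¬𝓟 w with leftWinsFirst⊎rightWinsSecond G
... | inj₁ l = l
... | inj₂ r = ⊥-elim (¬𝓟 (r , w))

StrictlyPFree-leftOpt : ∀ {G' G} → G' ∈ leftOpts G → StrictlyPFree G → StrictlyPFree G'
StrictlyPFree-leftOpt p pf s = pf (sp-left p s)

StrictlyPFree-rightOpt : ∀ {G' G} → G' ∈ rightOpts G → StrictlyPFree G → StrictlyPFree G'
StrictlyPFree-rightOpt p pf s = pf (sp-right p s)

mutual
  leftWinsFirst-⊕-blocked : ∀ {G H} → BlockedLeftEnd H → StrictlyPFree G →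
    LeftWinsFirst G → LeftWinsFirst (G ⊕ H)
  leftWinsFirst-⊕-blocked (bl _) _ lf-end = lf-end
  leftWinsFirst-⊕-blocked {G} {H} bH@(bl _) pf (lf-move p w) =
    lf-move (∈-leftOpts-⊕ˡ G H p)
      (leftWinsSecond-⊕-blocked bH (StrictlyPFree-leftOpt p pf)
        (leftWinsSecond⇒leftWinsFirst (StrictlyPFree-leftOpt p pf sp-refl) w) w)

  leftWinsSecond-⊕-blocked : ∀ {G H} → BlockedLeftEnd H → StrictlyPFree G →
    LeftWinsFirst G → LeftWinsSecond G → LeftWinsSecond (G ⊕ H)
  leftWinsSecond-⊕-blocked {G} {H} bH@(bl h) pf l (ls f) =
    ls (∈-rightOpts-⊕-elim G H LeftWinsFirst
         (λ p → leftWinsFirst-⊕-blocked bH (StrictlyPFree-rightOpt p pf) (f p))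
         (λ p → leftWinsFirst-⊕-rightOptOfBlocked (h p) pf l (ls f)))

  leftWinsFirst-⊕-rightOptOfBlocked : ∀ {G H'} →
    BlockedLeftEnd H' ⊎ (∃[ Y ] Y ∈ leftOpts H' × BlockedLeftEnd Y) →
    StrictlyPFree G → LeftWinsFirst G → LeftWinsSecond G → LeftWinsFirst (G ⊕ H')
  leftWinsFirst-⊕-rightOptOfBlocked (inj₁ bH') pf l _ = leftWinsFirst-⊕-blocked bH' pf l
  leftWinsFirst-⊕-rightOptOfBlocked {G@(game _ _)} {H'@(game _ _)} (inj₂ (_ , p , bY)) pf l w =
    lf-move (∈-leftOpts-⊕ʳ G H' p) (leftWinsSecond-⊕-blocked bY pf l w)

𝓛-⊕-blockedLeftEnd : ∀ {G H} → BlockedLeftEnd H → StrictlyPFree G →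
  G HasOutcome 𝓛 → (G ⊕ H) HasOutcome 𝓛
𝓛-⊕-blockedLeftEnd bH pf (l , w) =
  leftWinsFirst-⊕-blocked bH pf l , leftWinsSecond-⊕-blocked bH pf l w

lemma4p1 : (G H : Game) → Blocking G → Blocking H →
    StrictlyPFree G → StrictlyPFree H →
    G HasOutcome 𝓛 → IsLeftEnd H →
    (G ⊕ H) HasOutcome 𝓛
lemma4p1 G H _ blockingH pfG _ 𝓛G endH =
  𝓛-⊕-blockedLeftEnd (proj₁ (blockingH sp-refl) endH) pfG 𝓛G
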